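{- Let $U$ be a row-strict composition tableau, $b_1,\dots,b_n$ positive integers, $U_0=U$ and $U_j=U_{j-1}\leftarrow b_j$ for $1\le j\le n$. Let $i<i'$ be rows of $U_n$ such that row $i$ is weakly longer than row $i'$. Suppose the insertion of $b_{k_1}$ adds a box in position $(\hat i,1)$ and the insertion of $b_{k_2}$ adds a box in position $(\hat i',1)$, where $\hat i,\hat i'$ denote the rows corresponding to rows $i,i'$ of $U_n$. Then $k_1<k_2$, and the corresponding row $\hat i$ is weakly longer than the corresponding row $\hat i'$ in each $U_j$ with $j\ge k_2$.
   Context: Diagrams: row $i$ of the diagram of a strong composition $\alpha$ has $\alpha_i$ left-justified boxes; $(i,j)$ is row $i$ (from the top), column $j$. A row-strict composition tableau (RCT) of shape $\alpha$ ($k$ parts, largest part $m$) is a filling with positive integers such that the first column weakly increases top to bottom, each row strictly decreases left to right, and (Triple Rule) after padding rows with zeros to a $k\times m$ array $\hat U$, for $1\le i_1<i_2\le k$, $2\le j\le m$: $\hat U(i_2,j)\neq0$ and $\hat U(i_2,j)>\hat U(i_1,j)$ imply $\hat U(i_2,j)\ge\hat U(i_1,j-1)$. RCT insertion $U\leftarrow b$ ($U$ an RCT with longest row length $m$, $b$ a positive integer): scan $U$ column by column from right to left, each column from top to bottom, starting in column $m+1$ with $b$ in hand. (1) In column $m+1$: if the current position is at the end of a row of length $m$ and $b$ is strictly less than the last entry of that row, place $b$ there and stop; otherwise continue at the top of column $m$. (2) Inductively, with entry $b_j$ in hand at the top of column $j$: (a) if the current position is empty, is at the end of a row of length $j-1$,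 and $b_j$ is strictly less than the last entry of that row, place $b_j$ there and stop; (b) if the current position is nonempty and holds $\tilde b_j\le b_j$ with $b_j$ strictly less than the entry immediately to the left of $\tilde b_j$, then $b_j$ replaces (bumps) $\tilde b_j$ and scanning of column $j$ continues with $\tilde b_j$ in hand, bumping whenever possible; after the last entry of column $j$, scanning continues at the top of column $j-1$. (3) If an entry $b_1$ is bumped into the first column, it is placed in a new row of length one that appears directly after the lowest row whose first-column entry is weakly less than $b_1$. Corresponding rows: if an insertion adds its new box at $(i,1)$ (a new row), then for each $r>i$ row $r$ of the new tableau corresponds to row $r-1$ of the old one and rows $r<i$ correspond to themselves; otherwise each row corresponds to the row with the same index. Following these correspondences, a row of $U_n$ either contains boxes of $U$, in which case it corresponds to a row in every $U_j$ ($0\le j\le n$), or consists only of added boxes and was created when some $b_k$ added a box at $(\hat i,1)$ of $U_k$, in which case it corresponds to a row $\hat i$ of each $U_j$, $j\ge k$. -}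

module Defs where

open import Data.Nat using (ℕ; zero; suc; _+_; _∸_; _≤_; _<_; _⊔_; _≤?_; _<?_; _≡ᵇ_)
open import Data.Bool using (Bool; true; false; if_then_else_; _∧_)
open import Data.List using (List; []; _∷_; length; foldr; _++_; [_])
open import Data.Maybe using (Maybe; just; nothing; _>>=_; fromMaybe)
open import Data.Product using (_×_; _,_; proj₁; proj₂)
open import Relation.Nullary.Decidable using (⌊_⌋)
open import Relation.Binary.PropositionalEquality using (_≡_; _≢_)

-- CONVENTIONS: rows and columns are indexed from 0 (paper's row i = our row i-1,
-- paper's column j = our column j-1).  A tableau is the list of its rows (top to
-- bottom), each row the list of its entries (left to right).

Tableau : Set
Tableau = List (List ℕ)

at : {A : Set} → List A → ℕ → Maybe A
at []       _       = nothing
at (x ∷ xs) zero    = just x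
at (x ∷ xs) (suc n) = at xs n

entry : Tableau → ℕ → ℕ → Maybe ℕ
entry U r c = at U r >>= λ w → at w c

hatU : Tableau → ℕ → ℕ → ℕ
hatU U r c = fromMaybe 0 (entry U r c)

rowLen : Tableau → ℕ → ℕ
rowLen U r = fromMaybe 0 (at U r >>= λ w → just (length w))

maxLen : Tableau → ℕ
maxLen = foldr (λ w m → length w ⊔ m) 0

record IsRCT (U : Tableau) : Set where
  field
    rowsNonempty : ∀ r → r < length U → 0 < rowLen U r
    positive     : ∀ r c x → entry U r c ≡ just x → 0 < x
    firstCol     : ∀ r → suc r < length U → hatU U r 0 ≤ hatU U (suc r) 0
    rowStrict    : ∀ r c x y → entry U r c ≡ just x → entry U r (suc c) ≡ just y → y < x
    -- Triple Rule (paper's 2 ≤ j ≤ m is our column suc j' with suc j' < m)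
    triple       : ∀ i₁ i₂ j' → i₁ < i₂ → i₂ < length U → suc j' < maxLen U →
                   hatU U i₂ (suc j') ≢ 0 →
                   hatU U i₁ (suc j') < hatU U i₂ (suc j') →
                   hatU U i₁ j' ≤ hatU U i₂ (suc j')

setAt : List ℕ → ℕ → ℕ → List ℕ
setAt []       _       _ = []
setAt (x ∷ xs) zero    b = b ∷ xs
setAt (x ∷ xs) (suc c) b = x ∷ setAt xs c b

data RowStep : Set where
  stop : List ℕ → RowStep
  bump : List ℕ → ℕ → RowStep      -- b bumped the entry, new entry in hand
  skip : RowStep

rowStep : ℕ → ℕ → List ℕ → RowStep
rowStep c' b w with at w c' | at w (suc c')
... | nothing | _       = skip
... | just l  | nothing =
      if ⌊ b <? l ⌋ then stop (w ++ [ b ]) else skip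
... | just l  | just t  =
      if ⌊ t ≤? b ⌋ ∧ ⌊ b <? l ⌋ then bump (setAt w (suc c') b) t else skip

data ColResult : Set where
  placed : Tableau → ℕ → ColResult   -- stopped; row index where the box was added
  carry  : Tableau → ℕ → ColResult   -- column finished, entry in hand

consRow : List ℕ → ColResult → ColResult
consRow w (placed U r) = placed (w ∷ U) (suc r)
consRow w (carry U b)  = carry (w ∷ U) b

scanCol : ℕ → ℕ → Tableau → ColResult
scanCol c' b []       = carry [] b
scanCol c' b (w ∷ ws) with rowStep c' b w
... | stop w'    = placed (w' ∷ ws) 0
... | bump w' b' = consRow w' (scanCol c' b' ws)
... | skip       = consRow w (scanCol c' b ws)

-- position of the new row of length one: directly after the lowest row whose
-- first entry is weakly less than b (position 0 if there is none)
newRowPos : Tableau → ℕ → ℕ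
newRowPos []       b = 0
newRowPos (w ∷ ws) b with newRowPos ws b
... | suc p = suc (suc p)
... | zero with at w 0
...   | nothing = 0
...   | just x  = if ⌊ x ≤? b ⌋ then 1 else 0

insAt : Tableau → ℕ → List ℕ → Tableau
insAt U        zero    v = v ∷ U
insAt []       (suc p) v = [ v ]
insAt (w ∷ ws) (suc p) v = w ∷ insAt ws p v

-- scan columns (suc c), c, …, 1 (0-based), then the first column.
-- Result: new tableau and position (row , column) of the added box.
scanFrom : ℕ → Tableau → ℕ → Tableau × (ℕ × ℕ)
scanFrom zero    U b = insAt U (newRowPos U b) [ b ] , (newRowPos U b , 0)
scanFrom (suc c) U b with scanCol c b U
... | placed U' r = U' , (r , suc c)
... | carry U' b' = scanFrom c U' b'

-- U ← b together with the position of the added box; scanning starts in the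
-- paper's column m+1, which is our 0-based column m.
insertPos : Tableau → ℕ → Tableau × (ℕ × ℕ)
insertPos U b = scanFrom (maxLen U) U b

insert : Tableau → ℕ → Tableau
insert U b = proj₁ (insertPos U b)

-- U j = U_j  (b j is b_j for 1 ≤ j; b 0 is unused)
seqT : Tableau → (ℕ → ℕ) → ℕ → Tableau
seqT U b zero    = U
seqT U b (suc j) = insert (seqT U b j) (b (suc j))

addedPos : Tableau → (ℕ → ℕ) → ℕ → ℕ × ℕ
addedPos U b j = proj₂ (insertPos (seqT U b j) (b (suc j)))

-- row of U_j corresponding to row r of U_(suc j); nothing for a newly created row
backRow : (ℕ × ℕ) → ℕ → Maybe ℕ
backRow (p , suc c) r = just r
backRow (p , zero)  r with ⌊ r <? p ⌋ | r ≡ᵇ p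
... | true  | _     = just r
... | false | true  = nothing
... | false | false = just (r ∸ 1)

-- corr U b j d r : the row of U_(j ∸ d) corresponding to row r of U_j
corr : Tableau → (ℕ → ℕ) → ℕ → ℕ → ℕ → Maybe ℕ
corr U b j       zero    r = just r
corr U b zero    (suc d) r = nothing
corr U b (suc j) (suc d) r = backRow (addedPos U b j) r >>= corr U b j d

-- First, a local analysis of one insertion U ← b.  It preserves the invariant
-- `Good` (strict positive rows, Triple Rule between any two rows), and changes
-- the shape in one of two ways (`ShapeChange`): a box is appended to a row p and
-- no row below p has the new length of p, or a new row of length one is created
-- and no row below it has length one.  During the column scan this rests on the
-- invariant `FitsBelow`: the entry in hand respects the Triple Rule below every row.
-- Second, we follow rows of U_n back through U_0, …, U_n: corresponding rows keep
-- their order, rows only grow, and an upper row strictly shorter than a lower one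
-- stays strictly shorter.  Since row i is weakly longer than row i' in U_n, the
-- row î is never strictly shorter than î'; this excludes k₂ < k₁ (the new row î
-- would have length one, above the row î' of length at least two) and gives the lengths.

module Submission where

open import Defs
open import Data.Nat using (ℕ; zero; suc; _∸_; _≤_; _<_; _+_; z≤n; s≤s; _≤?_; _<?_; _≡ᵇ_)
open import Data.Nat.Properties
open import Data.Bool using (T; true; false)
open import Data.Unit using (tt)
open import Data.List using (List; []; _∷_; length; _++_; [_])
open import Data.List.Relation.Unary.All as All using (All; []; _∷_)
open import Data.List.Relation.Unary.AllPairs using (AllPairs; []; _∷_)
open import Data.Maybe using (Maybe; just; nothing; _>>=_; fromMaybe)
open import Data.Maybe.Properties using (just-injective)
open import Data.Product using (_×_; _,_; proj₁; proj₂; ∃; ∃₂)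
open import Data.Sum using (_⊎_; inj₁; inj₂)
open import Data.Empty using (⊥; ⊥-elim)
open import Relation.Nullary using (yes; no)
open import Relation.Binary using (tri<; tri≈; tri>)
open import Relation.Binary.PropositionalEquality hiding ([_])

cell : List ℕ → ℕ → ℕ
cell w k = fromMaybe 0 (at w k)

cell-just : ∀ w k {x} → at w k ≡ just x → cell w k ≡ x
cell-just w k e = cong (fromMaybe 0) e

cell-nothing : ∀ w k → at w k ≡ nothing → cell w k ≡ 0
cell-nothing w k e = cong (fromMaybe 0) e

cell-pos : ∀ w k → 0 < cell w k → at w k ≡ just (cell w k)
cell-pos w k p with at w k
... | just x  = refl
... | nothing = ⊥-elim (<-irrefl refl p)

at-just⇒< : ∀ {A : Set} (w : List A) k {x} → at w k ≡ just x → k < length w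
at-just⇒< []      k       ()
at-just⇒< (y ∷ w) zero    e = s≤s z≤n
at-just⇒< (y ∷ w) (suc k) e = s≤s (at-just⇒< w k e)

at-nothing⇒≥ : ∀ (w : List ℕ) k → at w k ≡ nothing → length w ≤ k
at-nothing⇒≥ []      k       e = z≤n
at-nothing⇒≥ (y ∷ w) zero    ()
at-nothing⇒≥ (y ∷ w) (suc k) e = s≤s (at-nothing⇒≥ w k e)

at-< : ∀ (w : List ℕ) k → k < length w → ∃ λ x → at w k ≡ just x
at-< []      k       ()
at-< (y ∷ w) zero    p       = y , refl
at-< (y ∷ w) (suc k) (s≤s p) = at-< w k p

at-≥ : ∀ (w : List ℕ) k → length w ≤ k → at w k ≡ nothing
at-≥ []      k       p       = refl
at-≥ (y ∷ w) zero    ()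
at-≥ (y ∷ w) (suc k) (s≤s p) = at-≥ w k p

at-prev : ∀ (w : List ℕ) k {x} → at w (suc k) ≡ just x → ∃ λ y → at w k ≡ just y
at-prev w k e = at-< w k (<-trans (n<1+n k) (at-just⇒< w (suc k) e))

at-nothing-suc : ∀ (w : List ℕ) k → at w k ≡ nothing → at w (suc k) ≡ nothing
at-nothing-suc w k e = at-≥ w (suc k) (≤-trans (at-nothing⇒≥ w k e) (n≤1+n k))

setAt-same : ∀ (w : List ℕ) k b {t} → at w k ≡ just t → at (setAt w k b) k ≡ just b
setAt-same []      k       b ()
setAt-same (x ∷ w) zero    b e = refl
setAt-same (x ∷ w) (suc k) b e = setAt-same w k b e

setAt-other : ∀ (w : List ℕ) j b k → k ≢ j → at (setAt w j b) k ≡ at w k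
setAt-other []      j       b k       ne = refl
setAt-other (x ∷ w) zero    b zero    ne = ⊥-elim (ne refl)
setAt-other (x ∷ w) zero    b (suc k) ne = refl
setAt-other (x ∷ w) (suc j) b zero    ne = refl
setAt-other (x ∷ w) (suc j) b (suc k) ne = setAt-other w j b k (λ e → ne (cong suc e))

setAt-length : ∀ (w : List ℕ) k b → length (setAt w k b) ≡ length w
setAt-length []      k       b = refl
setAt-length (x ∷ w) zero    b = refl
setAt-length (x ∷ w) (suc k) b = cong suc (setAt-length w k b)

snoc-length : ∀ (w : List ℕ) b → length (w ++ [ b ]) ≡ suc (length w)
snoc-length []      b = refl
snoc-length (x ∷ w) b = cong suc (snoc-length w b)

snoc-last : ∀ (w : List ℕ) c' b {l} → at w c' ≡ just l → at w (suc c') ≡ nothing →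
            at (w ++ [ b ]) (suc c') ≡ just b
snoc-last []          c'       b ()        e₂
snoc-last (x ∷ [])    zero     b e₁        e₂ = refl
snoc-last (x ∷ y ∷ w) zero     b e₁        ()
snoc-last (x ∷ w)     (suc c') b e₁        e₂ = snoc-last w c' b e₁ e₂

snoc-other : ∀ (w : List ℕ) c' b {l} → at w c' ≡ just l → at w (suc c') ≡ nothing →
             ∀ k → k ≢ suc c' → at (w ++ [ b ]) k ≡ at w k
snoc-other []          c'       b ()  e₂ k             ne
snoc-other (x ∷ [])    zero     b e₁  e₂ zero          ne = refl
snoc-other (x ∷ [])    zero     b e₁  e₂ (suc zero)    ne = ⊥-elim (ne refl)
snoc-other (x ∷ [])    zero     b e₁  e₂ (suc (suc k)) ne = refl
snoc-other (x ∷ y ∷ w) zero     b e₁  () k             ne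
snoc-other (x ∷ w)     (suc c') b e₁  e₂ zero          ne = refl
snoc-other (x ∷ w)     (suc c') b e₁  e₂ (suc k)       ne =
  snoc-other w c' b e₁ e₂ k (λ e → ne (cong suc e))

n≢1+n : ∀ n → n ≢ suc n
n≢1+n n e = 1+n≢n (sym e)

All-at : ∀ {P : List ℕ → Set} (S : Tableau) s {q} → All P S → at S s ≡ just q → P q
All-at []      s       []       ()
All-at (w ∷ S) zero    (p ∷ ps) refl = p
All-at (w ∷ S) (suc s) (p ∷ ps) e    = All-at S s ps e

All-fromAt : ∀ {P : List ℕ → Set} (S : Tableau) → (∀ s q → at S s ≡ just q → P q) → All P S
All-fromAt []      f = []
All-fromAt (w ∷ S) f = f 0 w refl ∷ All-fromAt S (λ s q e → f (suc s) q e)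

rowLen-at : ∀ (S : Tableau) s {q} → at S s ≡ just q → rowLen S s ≡ length q
rowLen-at []      s       ()
rowLen-at (w ∷ S) zero    refl = refl
rowLen-at (w ∷ S) (suc s) e    = rowLen-at S s e

rowLen-≢ : ∀ (S : Tableau) s n → (∀ q → at S s ≡ just q → length q ≢ suc n) → rowLen S s ≢ suc n
rowLen-≢ []      s       n f ()
rowLen-≢ (w ∷ S) zero    n f = f w refl
rowLen-≢ (w ∷ S) (suc s) n f = rowLen-≢ S s n f

length≤maxLen : ∀ (U : Tableau) s q → at U s ≡ just q → length q ≤ maxLen U
length≤maxLen []      s       q ()
length≤maxLen (w ∷ U) zero    q refl = m≤m⊔n (length w) (maxLen U)
length≤maxLen (w ∷ U) (suc s) q e    = ≤-trans (length≤maxLen U s q e) (m≤n⊔m (length w) (maxLen U))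

TripleRule : List ℕ → List ℕ → Set
TripleRule w q = ∀ c v → at q (suc c) ≡ just v → cell w (suc c) < v → cell w c ≤ v

StrictRow : List ℕ → Set
StrictRow w = ∀ k x y → at w k ≡ just x → at w (suc k) ≡ just y → y < x

PositiveRow : List ℕ → Set
PositiveRow w = ∀ k x → at w k ≡ just x → 0 < x

-- The RCT conditions on entries that the argument needs; insertion preserves them.
Good : Tableau → Set
Good S = AllPairs TripleRule S × All StrictRow S × All PositiveRow S

-- The value e, placed in column k+1 of a row below q, satisfies the Triple Rule
-- against q.  Entries in hand during the scan of column k have this property
-- for every row.
FitsBelow : ℕ → ℕ → List ℕ → Set
FitsBelow k e q = cell q (suc k) < e → cell q k ≤ e

entry-at : ∀ U r c {w} → at U r ≡ just w → entry U r c ≡ at w c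
entry-at U r c e = cong (λ m → m >>= λ w → at w c) e

hatU-at : ∀ U r c {w} → at U r ≡ just w → hatU U r c ≡ cell w c
hatU-at U r c e = cong (fromMaybe 0) (entry-at U r c e)

AllPairs-fromAt : ∀ {R : List ℕ → List ℕ → Set} (U : Tableau) →
  (∀ i₁ i₂ w q → i₁ < i₂ → at U i₁ ≡ just w → at U i₂ ≡ just q → R w q) → AllPairs R U
AllPairs-fromAt []      f = []
AllPairs-fromAt (w ∷ U) f =
  All-fromAt U (λ s q e → f 0 (suc s) w q (s≤s z≤n) refl e) ∷
  AllPairs-fromAt U (λ i₁ i₂ w' q lt e₁ e₂ → f (suc i₁) (suc i₂) w' q (s≤s lt) e₁ e₂)

rctGood : ∀ U → IsRCT U → Good U
rctGood U rct =
  AllPairs-fromAt U triple ,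
  All-fromAt U (λ s w e k x y ex ey →
    IsRCT.rowStrict rct s k x y (trans (entry-at U s k e) ex) (trans (entry-at U s (suc k) e) ey)) ,
  All-fromAt U (λ s w e k x ex → IsRCT.positive rct s k x (trans (entry-at U s k e) ex))
  where
  triple : ∀ i₁ i₂ w q → i₁ < i₂ → at U i₁ ≡ just w → at U i₂ ≡ just q → TripleRule w q
  triple i₁ i₂ w q lt e₁ e₂ c v ev prem =
    let hv   = trans (hatU-at U i₂ (suc c) e₂) (cell-just q (suc c) ev)
        vpos = IsRCT.positive rct i₂ (suc c) v (trans (entry-at U i₂ (suc c) e₂) ev)
    in subst₂ _≤_ (hatU-at U i₁ c e₁) hv
         (IsRCT.triple rct i₁ i₂ c lt (at-just⇒< U i₂ e₂)
            (<-≤-trans (at-just⇒< q (suc c) ev) (length≤maxLen U i₂ q e₂))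
            (λ z → <-irrefl (sym (trans (sym hv) z)) vpos)
            (subst₂ _<_ (sym (hatU-at U i₁ (suc c) e₁)) (sym hv) prem))

-- Initially the inserted value fits below every row, since nothing lies to the
-- right of the longest row.
fitsBelowInitially : ∀ S h → All (FitsBelow (maxLen S) h) S
fitsBelowInitially S h = All-fromAt S (λ s q e _ →
  subst (_≤ h) (sym (cell-nothing q (maxLen S) (at-≥ q (maxLen S) (length≤maxLen S s q e)))) z≤n)

data StepView (c' h : ℕ) (w : List ℕ) : RowStep → Set where
  vstop : ∀ l → at w c' ≡ just l → at w (suc c') ≡ nothing → h < l →
          StepView c' h w (stop (w ++ [ h ]))
  vbump : ∀ l t → at w c' ≡ just l → at w (suc c') ≡ just t → t ≤ h → h < l →
          StepView c' h w (bump (setAt w (suc c') h) t)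
  vskip : (h ≤ cell w (suc c') ⊎ cell w c' ≤ h) → StepView c' h w skip

stepView : ∀ c' h w → StepView c' h w (rowStep c' h w)
stepView c' h w with at w c' in e₁ | at w (suc c') in e₂
... | nothing | _ = vskip (inj₂ (subst (_≤ h) (sym (cell-nothing w c' e₁)) z≤n))
... | just l  | nothing with h <? l
...   | yes p = vstop l e₁ e₂ p
...   | no  p = vskip (inj₂ (subst (_≤ h) (sym (cell-just w c' e₁)) (≮⇒≥ p)))
stepView c' h w | just l | just t with t ≤? h | h <? l
...   | yes p | yes q = vbump l t e₁ e₂ p q
...   | yes p | no  q = vskip (inj₂ (subst (_≤ h) (sym (cell-just w c' e₁)) (≮⇒≥ q)))
...   | no  p | _     = vskip (inj₁ (subst (h ≤_) (sym (cell-just w (suc c') e₂)) (<⇒≤ (≰⇒> p))))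

AgreeExcept : ℕ → List ℕ → List ℕ → Set
AgreeExcept d w w' = ∀ k → k ≢ d → at w' k ≡ at w k

agreeRefl : ∀ {d} w → AgreeExcept d w w
agreeRefl w _ _ = refl

cell-agree : ∀ {d w w' k} → AgreeExcept d w w' → k ≢ d → cell w' k ≡ cell w k
cell-agree {k = k} s ne = cong (fromMaybe 0) (s k ne)

EntryAt : ℕ → (ℕ → Set) → List ℕ → Set
EntryAt d P q = ∀ v → at q d ≡ just v → P v

AllAfter : (ℕ → Set) → (List ℕ → Set) → ColResult → Set
AllAfter P Q' (placed S' r) = All Q' S'
AllAfter P Q' (carry S' h') = All Q' S' × P h'

consAllAfter : ∀ {P Q'} w R → Q' w → AllAfter P Q' R → AllAfter P Q' (consRow w R)
consAllAfter w (placed S r) q a       = q ∷ a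
consAllAfter w (carry S h)  q (a , p) = (q ∷ a) , p

-- A scan of column c'+1 only rewrites that column, and every value it writes or
-- leaves in hand comes from the "pool" of the value in hand and the old entries
-- of that column.  So if the pool satisfies P, any property Q of the old rows
-- that is transferred to Q' by such rewrites holds for the new rows.
scanTransfer : ∀ c' h (ws : Tableau) (P : ℕ → Set) (Q Q' : List ℕ → Set) →
  (∀ q q' → AgreeExcept (suc c') q q' → EntryAt (suc c') P q' → Q q → Q' q') →
  P h → All (λ q → Q q × EntryAt (suc c') P q) ws → AllAfter P Q' (scanCol c' h ws)
scanTransfer c' h []       P Q Q' tr ph [] = [] , ph
scanTransfer c' h (w ∷ ws) P Q Q' tr ph ((qw , pw) ∷ rest) with rowStep c' h w | stepView c' h w
... | _ | vstop l e₁ e₂ hl =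
  tr w (w ++ [ h ]) (snoc-other w c' h e₁ e₂)
     (λ v e → subst P (just-injective (trans (sym (snoc-last w c' h e₁ e₂)) e)) ph) qw
  ∷ All.map (λ {q} x → tr q q (agreeRefl q) (proj₂ x) (proj₁ x)) rest
... | _ | vbump l t e₁ e₂ th hl =
  consAllAfter (setAt w (suc c') h) (scanCol c' t ws)
    (tr w (setAt w (suc c') h) (setAt-other w (suc c') h)
       (λ v e → subst P (just-injective (trans (sym (setAt-same w (suc c') h e₂)) e)) ph) qw)
    (scanTransfer c' t ws P Q Q' tr (pw t e₂) rest)
... | _ | vskip _ =
  consAllAfter w (scanCol c' h ws) (tr w w (agreeRefl w) pw qw) (scanTransfer c' h ws P Q Q' tr ph rest)

TripleAt : List ℕ → ℕ → ℕ → Set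
TripleAt w c' v = v ≤ cell w (suc c') ⊎ cell w c' ≤ v

tripleAtOfRule : ∀ c' w q → TripleRule w q → EntryAt (suc c') (TripleAt w c') q
tripleAtOfRule c' w q rule v e with v ≤? cell w (suc c')
... | yes p = inj₁ p
... | no  p = inj₂ (rule c' v e (≰⇒> p))

-- The Triple Rule between w and q survives when column c'+1 of the upper row
-- is weakly increased and column c'+1 of the lower row is rewritten by a value
-- compatible with w; only column c'+2 of the lower row has to be checked anew.
tripleRuleAfterWrite : ∀ c' w w' q q' → AgreeExcept (suc c') w w' →
  cell w (suc c') ≤ cell w' (suc c') → TripleRule w q →
  (∀ v → at q (suc (suc c')) ≡ just v → cell w (suc (suc c')) < v → cell w' (suc c') ≤ v) →
  AgreeExcept (suc c') q q' → EntryAt (suc c') (TripleAt w c') q' → TripleRule w' q'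
tripleRuleAfterWrite c' w w' q q' sw le rule next sq new c v e lt with c ≟ suc c'
... | yes refl =
  next v (trans (sym (sq (suc (suc c')) (λ x → n≢1+n (suc c') (sym x)))) e)
       (subst (_< v) (cell-agree {w = w} {w' = w'} sw (λ x → n≢1+n (suc c') (sym x))) lt)
... | no c≢d with suc c ≟ suc c'
...   | yes refl with new v e
...     | inj₁ x = ⊥-elim (<-irrefl refl (<-≤-trans lt (≤-trans x le)))
...     | inj₂ x = subst (_≤ v) (sym (cell-agree {w = w} {w' = w'} sw (n≢1+n c'))) x
tripleRuleAfterWrite c' w w' q q' sw le rule next sq new c v e lt | no c≢d | no sc≢d =
  subst (_≤ v) (sym (cell-agree {w = w} {w' = w'} sw c≢d))
    (rule c v (trans (sym (sq (suc c) sc≢d)) e)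
       (subst (_< v) (cell-agree {w = w} {w' = w'} sw sc≢d) lt))

strictAfterWrite : ∀ c' w w' h l → StrictRow w → AgreeExcept (suc c') w w' →
  at w' (suc c') ≡ just h → at w c' ≡ just l → h < l →
  (∀ y → at w (suc (suc c')) ≡ just y → y < h) → StrictRow w'
strictAfterWrite c' w w' h l sw so eh el hl right k x y ex ey with k ≟ c'
... | yes refl =
  subst (_< x) (just-injective (trans (sym eh) ey))
    (subst (h <_) (just-injective (trans (sym el) (trans (sym (so c' (n≢1+n c'))) ex))) hl)
... | no k≢c' with k ≟ suc c'
...   | yes refl =
  subst (y <_) (just-injective (trans (sym eh) ex))
    (right y (trans (sym (so (suc (suc c')) (λ z → n≢1+n (suc c') (sym z)))) ey))
...   | no k≢d =
  sw k x y (trans (sym (so k k≢d)) ex) (trans (sym (so (suc k) (λ z → k≢c' (suc-injective z)))) ey)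

positiveAfterWrite : ∀ d w w' h → PositiveRow w → AgreeExcept d w w' → at w' d ≡ just h → 0 < h →
  PositiveRow w'
positiveAfterWrite d w w' h pw so eh hp k x ex with k ≟ d
... | yes refl = subst (0 <_) (just-injective (trans (sym eh) ex)) hp
... | no  k≢d  = pw k x (trans (sym (so k k≢d)) ex)

writtenFitsAbove : ∀ c' h l w q → at w c' ≡ just l → h < l → TripleRule w q →
  FitsBelow (suc c') h q → StrictRow q →
  ∀ v → at q (suc (suc c')) ≡ just v → cell w (suc (suc c')) < v → h ≤ v
writtenFitsAbove c' h l w q el hl rule fits sq v ev prem with h ≤? v
... | yes p = p
... | no  p with at-prev q (suc c') ev
...   | y , ey =
  let v<y  = sq (suc c') y v ey ev
      y≤h  = subst (_≤ h) (cell-just q (suc c') ey)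
               (fits (subst (_< h) (sym (cell-just q (suc (suc c')) ev)) (≰⇒> p)))
      wv   = rule (suc c') v ev prem
      l≤y  = subst (_≤ y) (cell-just w c' el) (rule c' y ey (≤-<-trans wv v<y))
  in ⊥-elim (<-irrefl refl (≤-<-trans (≤-trans l≤y y≤h) hl))

fitsBelowAfterBump : ∀ c' h l t w q → at w c' ≡ just l → at w (suc c') ≡ just t → t ≤ h → h < l →
  TripleRule w q → FitsBelow (suc c') h q → FitsBelow (suc c') t q
fitsBelowAfterBump c' h l t w q el et th hl rule fits prem with cell q (suc c') ≤? t
... | yes p = p
... | no  p =
  let y≤h = fits (<-≤-trans prem th)
      t<y = ≰⇒> p
      ey  = cell-pos q (suc c') (≤-<-trans z≤n t<y)
      l≤y = subst (_≤ cell q (suc c')) (cell-just w c' el)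
              (rule c' (cell q (suc c')) ey (subst (_< cell q (suc c')) (sym (cell-just w (suc c') et)) t<y))
  in ⊥-elim (<-irrefl refl (≤-<-trans (≤-trans l≤y y≤h) hl))

-- When h is appended to w (of length c'+1), no lower row q can have the new
-- length c'+2 of w: its last entry u would satisfy l ≤ u ≤ h < l.
appendedLengthUnmatched : ∀ c' h l w q → at w c' ≡ just l → at w (suc c') ≡ nothing → h < l → 0 < h →
  TripleRule w q → FitsBelow (suc c') h q → PositiveRow q → length q ≢ suc (length w)
appendedLengthUnmatched c' h l w q el en hl hp rule fits posq eq =
  let lw : length w ≡ suc c'
      lw = ≤-antisym (at-nothing⇒≥ w (suc c') en) (at-just⇒< w c' el)
      lq : length q ≡ suc (suc c')
      lq = trans eq (cong suc lw)
      (u , eu) = at-< q (suc c') (subst (suc c' <_) (sym lq) (n<1+n (suc c')))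
      en' = at-≥ q (suc (suc c')) (≤-reflexive lq)
      u≤h = subst (_≤ h) (cell-just q (suc c') eu)
              (fits (subst (_< h) (sym (cell-nothing q (suc (suc c')) en')) hp))
      l≤u = subst (_≤ u) (cell-just w c' el)
              (rule c' u eu (subst (_< u) (sym (cell-nothing w (suc c') en)) (posq (suc c') u eu)))
  in <-irrefl refl (≤-<-trans (≤-trans l≤u u≤h) hl)

SameLengths : Tableau → Tableau → Set
SameLengths S' S = ∀ s → rowLen S' s ≡ rowLen S s

BoxAppended : Tableau → Tableau → ℕ → Set
BoxAppended S S' r = (∀ s → s ≢ r → rowLen S' s ≡ rowLen S s) × rowLen S' r ≡ suc (rowLen S r) ×
                     (∀ s → r < s → rowLen S s ≢ suc (rowLen S r))

ScanOutcome : ℕ → ℕ → Tableau → ColResult → Set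
ScanOutcome c' h S (placed S' r) = Good S' × BoxAppended S S' r
ScanOutcome c' h S (carry S' h') = Good S' × 0 < h' × h' ≤ h × All (FitsBelow c' h') S' × SameLengths S' S

boxAppended-cons : ∀ w w' ws S' r → length w' ≡ length w → BoxAppended ws S' r →
  BoxAppended (w ∷ ws) (w' ∷ S') (suc r)
boxAppended-cons w w' ws S' r len (others , grown , unmatched) =
  (λ { zero ne → len ; (suc s) ne → others s (λ e → ne (cong suc e)) }) , grown ,
  (λ { zero () ; (suc s) (s≤s p) → unmatched s p })

sameLengths-cons : ∀ w w' ws S' → length w' ≡ length w → SameLengths S' ws → SameLengths (w' ∷ S') (w ∷ ws)
sameLengths-cons w w' ws S' len same zero    = len
sameLengths-cons w w' ws S' len same (suc s) = same s

tripleRuleBelowWrite : ∀ c' h l w w' → at w c' ≡ just l → h < l → AgreeExcept (suc c') w w' →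
  at w' (suc c') ≡ just h → cell w (suc c') ≤ h →
  ∀ q q' → AgreeExcept (suc c') q q' → EntryAt (suc c') (TripleAt w c') q' →
  TripleRule w q × FitsBelow (suc c') h q × StrictRow q → TripleRule w' q'
tripleRuleBelowWrite c' h l w w' el hl so eh le q q' sq new (rule , fits , sq') =
  tripleRuleAfterWrite c' w w' q q' so (subst (cell w (suc c') ≤_) (sym hw') le) rule
    (λ v ev prem → subst (_≤ v) (sym hw') (writtenFitsAbove c' h l w q el hl rule fits sq' v ev prem))
    sq new
  where
  hw' : cell w' (suc c') ≡ h
  hw' = cell-just w' (suc c') eh

scanStop : ∀ c' h w ws l → at w c' ≡ just l → at w (suc c') ≡ nothing → h < l → 0 < h →
  Good (w ∷ ws) → All (FitsBelow (suc c') h) ws →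
  ScanOutcome c' h (w ∷ ws) (placed ((w ++ [ h ]) ∷ ws) 0)
scanStop c' h w ws l e₁ e₂ hl hp (rw ∷ rs , sw ∷ ss , pw ∷ ps) fits =
  (rules ∷ rs , strict ∷ ss , positiveAfterWrite (suc c') w w' h pw so eh hp ∷ ps) ,
  (λ { zero ne → ⊥-elim (ne refl) ; (suc s) ne → refl }) , snoc-length w h ,
  (λ { zero () ; (suc s) _ → rowLen-≢ ws s (length w) (λ q e →
        appendedLengthUnmatched c' h l w q e₁ e₂ hl hp (All-at ws s rw e) (All-at ws s fits e) (All-at ws s ps e)) })
  where
  w' = w ++ [ h ]
  so = snoc-other w c' h e₁ e₂
  eh = snoc-last w c' h e₁ e₂
  rules = All.map (λ {q} x → tripleRuleBelowWrite c' h l w w' e₁ hl so eh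
                     (subst (_≤ h) (sym (cell-nothing w (suc c') e₂)) z≤n) q q (agreeRefl q)
                     (tripleAtOfRule c' w q (proj₁ x)) x)
            (All.zip (rw , All.zip (fits , ss)))
  strict = strictAfterWrite c' w w' h l sw so eh e₁ hl
             (λ y ey → ⊥-elim (just≢nothing (trans (sym ey) (at-nothing-suc w (suc c') e₂))))
    where
    just≢nothing : ∀ {y : ℕ} → just y ≢ nothing
    just≢nothing ()

scanBump : ∀ c' h w ws l t → at w c' ≡ just l → at w (suc c') ≡ just t → t ≤ h → h < l → 0 < h →
  StrictRow w → PositiveRow w →
  (R : ColResult) → ScanOutcome c' t ws R → AllAfter (TripleAt w c') (TripleRule (setAt w (suc c') h)) R →
  ScanOutcome c' h (w ∷ ws) (consRow (setAt w (suc c') h) R)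
scanBump c' h w ws l t e₁ e₂ th hl hp sw pw (placed S' r) (good , box) rules =
  (rules ∷ proj₁ good , strict ∷ proj₁ (proj₂ good) , positive ∷ proj₂ (proj₂ good)) ,
  boxAppended-cons w (setAt w (suc c') h) ws S' r (setAt-length w (suc c') h) box
  where
  strict : StrictRow (setAt w (suc c') h)
  strict = strictAfterWrite c' w (setAt w (suc c') h) h l sw (setAt-other w (suc c') h) (setAt-same w (suc c') h e₂) e₁ hl
             (λ y ey → <-≤-trans (sw (suc c') t y e₂ ey) th)
  positive : PositiveRow (setAt w (suc c') h)
  positive = positiveAfterWrite (suc c') w (setAt w (suc c') h) h pw (setAt-other w (suc c') h) (setAt-same w (suc c') h e₂) hp
scanBump c' h w ws l t e₁ e₂ th hl hp sw pw (carry S' h') (good , h'pos , h'≤t , fits , same) (rules , _) =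
  (rules ∷ proj₁ good , strict ∷ proj₁ (proj₂ good) , positive ∷ proj₂ (proj₂ good)) ,
  h'pos , ≤-trans h'≤t th , fitsW ∷ fits ,
  sameLengths-cons w (setAt w (suc c') h) ws S' (setAt-length w (suc c') h) same
  where
  eh : at (setAt w (suc c') h) (suc c') ≡ just h
  eh = setAt-same w (suc c') h e₂
  strict : StrictRow (setAt w (suc c') h)
  strict = strictAfterWrite c' w (setAt w (suc c') h) h l sw (setAt-other w (suc c') h) eh e₁ hl
             (λ y ey → <-≤-trans (sw (suc c') t y e₂ ey) th)
  positive : PositiveRow (setAt w (suc c') h)
  positive = positiveAfterWrite (suc c') w (setAt w (suc c') h) h pw (setAt-other w (suc c') h) eh hp
  -- h' ≤ t ≤ h, and h is now the entry of w in column c'+1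
  fitsW : FitsBelow c' h' (setAt w (suc c') h)
  fitsW prem = ⊥-elim (<-irrefl refl
    (<-≤-trans (subst (_< h') (cell-just (setAt w (suc c') h) (suc c') eh) prem) (≤-trans h'≤t th)))

scanSkip : ∀ c' h w ws → StrictRow w → PositiveRow w →
  (R : ColResult) → ScanOutcome c' h ws R → AllAfter (TripleAt w c') (TripleRule w) R →
  ScanOutcome c' h (w ∷ ws) (consRow w R)
scanSkip c' h w ws sw pw (placed S' r) (good , box) rules =
  (rules ∷ proj₁ good , sw ∷ proj₁ (proj₂ good) , pw ∷ proj₂ (proj₂ good)) ,
  boxAppended-cons w w ws S' r refl box
scanSkip c' h w ws sw pw (carry S' h') (good , h'pos , h'≤h , fits , same) (rules , compatible) =
  (rules ∷ proj₁ good , sw ∷ proj₁ (proj₂ good) , pw ∷ proj₂ (proj₂ good)) ,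
  h'pos , h'≤h , fitsW compatible ∷ fits , sameLengths-cons w w ws S' refl same
  where
  fitsW : TripleAt w c' h' → FitsBelow c' h' w
  fitsW (inj₁ x) prem = ⊥-elim (<-irrefl refl (<-≤-trans prem x))
  fitsW (inj₂ x) prem = x

scanLemma : ∀ c' h S → Good S → 0 < h → All (FitsBelow (suc c') h) S → ScanOutcome c' h S (scanCol c' h S)
scanLemma c' h [] _ hp _ = ([] , [] , []) , hp , ≤-refl , [] , (λ s → refl)
scanLemma c' h (w ∷ ws) good@(rw ∷ rs , sw ∷ ss , pw ∷ ps) hp (_ ∷ fits)
  with rowStep c' h w | stepView c' h w
... | _ | vstop l e₁ e₂ hl = scanStop c' h w ws l e₁ e₂ hl hp good fits
... | _ | vbump l t e₁ e₂ th hl =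
  scanBump c' h w ws l t e₁ e₂ th hl hp sw pw (scanCol c' t ws)
    (scanLemma c' t ws (rs , ss , ps) (pw (suc c') t e₂)
       (All.map (λ {q} x → fitsBelowAfterBump c' h l t w q e₁ e₂ th hl (proj₁ x) (proj₂ x)) (All.zip (rw , fits))))
    (scanTransfer c' t ws (TripleAt w c') _ _
       (tripleRuleBelowWrite c' h l w (setAt w (suc c') h) e₁ hl (setAt-other w (suc c') h)
          (setAt-same w (suc c') h e₂) (subst (_≤ h) (sym (cell-just w (suc c') e₂)) th))
       (inj₁ (≤-reflexive (sym (cell-just w (suc c') e₂))))
       (All.map (λ {q} x → x , tripleAtOfRule c' w q (proj₁ x)) (All.zip (rw , All.zip (fits , ss)))))
... | _ | vskip compatible =
  scanSkip c' h w ws sw pw (scanCol c' h ws) (scanLemma c' h ws (rs , ss , ps) hp fits)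
    (scanTransfer c' h ws (TripleAt w c') (TripleRule w) (TripleRule w)
       (λ q q' sq new rule → tripleRuleAfterWrite c' w w q q' (agreeRefl w) ≤-refl rule (rule (suc c')) sq new)
       compatible (All.map (λ {q} rule → rule , tripleAtOfRule c' w q rule) rw))

StartsAbove : ℕ → List ℕ → Set
StartsAbove h q = ∀ f → at q 0 ≡ just f → h < f

newRowPos-≤ : ∀ S h → newRowPos S h ≤ length S
newRowPos-≤ []       h = z≤n
newRowPos-≤ (w ∷ ws) h with newRowPos ws h | newRowPos-≤ ws h
... | suc p | le = s≤s le
... | zero  | _ with at w 0
...   | nothing = z≤n
...   | just x with x ≤? h
...     | yes _ = s≤s z≤n
...     | no  _ = z≤n

newRowPos-below : ∀ S h s q → newRowPos S h ≤ s → at S s ≡ just q → StartsAbove h q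
newRowPos-below []       h s q le ()
newRowPos-below (w ∷ ws) h s q le eq with newRowPos ws h | newRowPos-below ws h
... | suc p | ih with s
...   | suc s' = ih s' q (≤-pred le) eq
newRowPos-below (w ∷ ws) h s q le eq | zero | ih with at w 0 in ew
... | nothing = below s eq
  where
  below : ∀ s → at (w ∷ ws) s ≡ just q → StartsAbove h q
  below zero     refl f ef with () ← trans (sym ew) ef
  below (suc s') e      = ih s' q z≤n e
... | just x with x ≤? h
...   | yes _ = below s le eq
  where
  below : ∀ s → 1 ≤ s → at (w ∷ ws) s ≡ just q → StartsAbove h q
  below (suc s') _ e = ih s' q z≤n e
...   | no x≰h = below s eq
  where
  below : ∀ s → at (w ∷ ws) s ≡ just q → StartsAbove h q
  below zero     refl f ef = subst (h <_) (just-injective (trans (sym ew) ef)) (≰⇒> x≰h)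
  below (suc s') e       = ih s' q z≤n e

All-insAt : ∀ {P : List ℕ → Set} (S : Tableau) p v → All P S → P v → All P (insAt S p v)
All-insAt S       zero    v a       pv = pv ∷ a
All-insAt []      (suc p) v a       pv = pv ∷ []
All-insAt (w ∷ S) (suc p) v (x ∷ a) pv = x ∷ All-insAt S p v a pv

tripleRule-above-single : ∀ w h → TripleRule w [ h ]
tripleRule-above-single w h c v ()

tripleRule-single-above : ∀ h q → StartsAbove h q → FitsBelow 0 h q → TripleRule [ h ] q
tripleRule-single-above h q starts fits zero v ev prem with h ≤? v
... | yes p = p
... | no  p with at-prev q 0 ev
...   | f , ef = ⊥-elim (<-irrefl refl (<-≤-trans (starts f ef)
          (subst (_≤ h) (cell-just q 0 ef) (fits (subst (_< h) (sym (cell-just q 1 ev)) (≰⇒> p))))))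
tripleRule-single-above h q starts fits (suc c) v ev prem = z≤n

strict-single : ∀ h → StrictRow [ h ]
strict-single h zero    x y ex ()
strict-single h (suc k) x y () ey

positive-single : ∀ h → 0 < h → PositiveRow [ h ]
positive-single h hp zero x refl = hp

insAtGood : ∀ S p h → p ≤ length S → (∀ s q → p ≤ s → at S s ≡ just q → StartsAbove h q) →
  Good S → 0 < h → All (FitsBelow 0 h) S → Good (insAt S p [ h ])
insAtGood S zero h le starts (rs , ss , ps) hp fits =
  All-fromAt S (λ s q e → tripleRule-single-above h q (starts s q z≤n e) (All-at S s fits e)) ∷ rs ,
  strict-single h ∷ ss , positive-single h hp ∷ ps
insAtGood [] (suc p) h () starts good hp fits
insAtGood (w ∷ S) (suc p) h (s≤s le) starts (rw ∷ rs , sw ∷ ss , pw ∷ ps) hp (_ ∷ fits) =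
  let (rs' , ss' , ps') = insAtGood S p h le (λ s q l e → starts (suc s) q (s≤s l) e) (rs , ss , ps) hp fits
  in All-insAt S p [ h ] rw (tripleRule-above-single w h) ∷ rs' , sw ∷ ss' , pw ∷ ps'

rowLen-insAt-< : ∀ (S : Tableau) p v s → p ≤ length S → s < p → rowLen (insAt S p v) s ≡ rowLen S s
rowLen-insAt-< []      (suc p) v s       ()       lt
rowLen-insAt-< (w ∷ S) (suc p) v zero    le       lt       = refl
rowLen-insAt-< (w ∷ S) (suc p) v (suc s) (s≤s le) (s≤s lt) = rowLen-insAt-< S p v s le lt

rowLen-insAt-≡ : ∀ (S : Tableau) p v → p ≤ length S → rowLen (insAt S p v) p ≡ length v
rowLen-insAt-≡ S       zero    v le       = refl
rowLen-insAt-≡ []      (suc p) v ()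
rowLen-insAt-≡ (w ∷ S) (suc p) v (s≤s le) = rowLen-insAt-≡ S p v le

rowLen-insAt-> : ∀ (S : Tableau) p v s → p ≤ length S → p ≤ s → rowLen (insAt S p v) (suc s) ≡ rowLen S s
rowLen-insAt-> S       zero    v s       le       lt       = refl
rowLen-insAt-> []      (suc p) v s       ()       lt
rowLen-insAt-> (w ∷ S) (suc p) v (suc s) (s≤s le) (s≤s lt) = rowLen-insAt-> S p v s le lt

RowCreated : Tableau → Tableau → ℕ → Set
RowCreated S S' p = (∀ s → s < p → rowLen S' s ≡ rowLen S s) × rowLen S' p ≡ 1 ×
                    (∀ s → p ≤ s → rowLen S' (suc s) ≡ rowLen S s × rowLen S s ≢ 1)

-- A row starting above h does not have length one: by `FitsBelow 0` its only
-- entry would be at most h.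
length-≢1 : ∀ h q → StartsAbove h q → FitsBelow 0 h q → 0 < h → length q ≢ 1
length-≢1 h q starts fits hp eq with at-< q 0 (subst (0 <_) (sym eq) (s≤s z≤n))
... | f , ef =
  <-irrefl refl (<-≤-trans (starts f ef)
    (subst (_≤ h) (cell-just q 0 ef) (fits (subst (_< h) (sym (cell-nothing q 1 (at-≥ q 1 (≤-reflexive eq)))) hp))))

newRowLemma : ∀ S h → Good S → 0 < h → All (FitsBelow 0 h) S →
  Good (insAt S (newRowPos S h) [ h ]) × RowCreated S (insAt S (newRowPos S h) [ h ]) (newRowPos S h)
newRowLemma S h good hp fits =
  insAtGood S p h le starts good hp fits ,
  (λ s lt → rowLen-insAt-< S p [ h ] s le lt) , rowLen-insAt-≡ S p [ h ] le ,
  (λ s l → rowLen-insAt-> S p [ h ] s le l ,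
           rowLen-≢ S s 0 (λ q e → length-≢1 h q (starts s q l e) (All-at S s fits e) hp))
  where
  p = newRowPos S h
  le = newRowPos-≤ S h
  starts : ∀ s q → p ≤ s → at S s ≡ just q → StartsAbove h q
  starts = newRowPos-below S h

ShapeChange : Tableau → Tableau × (ℕ × ℕ) → Set
ShapeChange S (S' , (p , suc c)) = BoxAppended S S' p
ShapeChange S (S' , (p , zero))  = RowCreated S S' p

-- Finished columns do not change the shape, so the shape change can be
-- measured against the tableau before them.
shapeChange-resp : ∀ S S' R → SameLengths S' S → ShapeChange S' R → ShapeChange S R
shapeChange-resp S S' (T , (p , suc c)) same (others , grown , unmatched) =
  (λ s ne → trans (others s ne) (same s)) , trans grown (cong suc (same p)) ,
  (λ s lt eq → unmatched s lt (trans (same s) (trans eq (cong suc (sym (same p))))))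
shapeChange-resp S S' (T , (p , zero)) same (before , one , after) =
  (λ s lt → trans (before s lt) (same s)) , one ,
  (λ s l → trans (proj₁ (after s l)) (same s) , (λ eq → proj₂ (after s l) (trans (same s) eq)))

scanFromLemma : ∀ c S h → Good S → 0 < h → All (FitsBelow c h) S →
  Good (proj₁ (scanFrom c S h)) × ShapeChange S (scanFrom c S h)
scanFromLemma zero    S h good hp fits = newRowLemma S h good hp fits
scanFromLemma (suc c) S h good hp fits with scanCol c h S | scanLemma c h S good hp fits
... | placed S' r | outcome = outcome
... | carry S' h' | (good' , hp' , _ , fits' , same) =
  let (good'' , shape) = scanFromLemma c S' h' good' hp' fits'
  in good'' , shapeChange-resp S S' (scanFrom c S' h') same shape

insertLemma : ∀ T x → Good T → 0 < x → Good (insert T x) × ShapeChange T (insertPos T x)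
insertLemma T x good hp = scanFromLemma (maxLen T) T x good hp (fitsBelowInitially T x)

backRow-created-inv : ∀ p r x → backRow (p , zero) r ≡ just x →
  (r < p × x ≡ r) ⊎ (∃ λ o → r ≡ suc o × p ≤ o × x ≡ o)
backRow-created-inv p r x eq with r <? p | r ≡ᵇ p in e
... | yes lt  | _     = inj₁ (lt , sym (just-injective eq))
... | no  r≮p | false = inj₂ (shifted r (≤∧≢⇒< (≮⇒≥ r≮p) (λ z → subst T e (≡⇒≡ᵇ r p (sym z)))) eq)
  where
  shifted : ∀ r → p < r → just (r ∸ 1) ≡ just x → ∃ λ o → r ≡ suc o × p ≤ o × x ≡ o
  shifted (suc o) (s≤s le) e' = o , refl , le , sym (just-injective e')
backRow-created-inv p r x () | no r≮p | true

backRow-shifted : ∀ p o → p ≤ o → backRow (p , zero) (suc o) ≡ just o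
backRow-shifted p o le with suc o <? p | suc o ≡ᵇ p in e
... | yes lt | _     = ⊥-elim (<-irrefl refl (<-≤-trans lt (≤-trans le (n≤1+n o))))
... | no _   | false = refl
... | no _   | true  = ⊥-elim (<-irrefl (sym (≡ᵇ⇒≡ (suc o) p (subst T (sym e) tt))) (s≤s le))

backRow-order : ∀ pos s s' r r' → s < s' → backRow pos s ≡ just r → backRow pos s' ≡ just r' → r < r'
backRow-order (p , suc c) s s' r r' lt refl refl = lt
backRow-order (p , zero)  s s' r r' lt e e' with backRow-created-inv p s r e | backRow-created-inv p s' r' e'
... | inj₁ (_ , refl)             | inj₁ (_ , refl)               = lt
... | inj₁ (sp , refl)            | inj₂ (o , refl , po , refl)   = <-≤-trans sp po
... | inj₂ (o , refl , po , refl) | inj₁ (sp , refl)              =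
  ⊥-elim (<-irrefl refl (<-trans (<-trans (s≤s po) lt) sp))
... | inj₂ (o , refl , po , refl) | inj₂ (o' , refl , po' , refl) = ≤-pred lt

rowCreated-length : ∀ S S' p → RowCreated S S' p →
  ∀ s r → backRow (p , 0) s ≡ just r → rowLen S' s ≡ rowLen S r
rowCreated-length S S' p (before , _ , after) s r e with backRow-created-inv p s r e
... | inj₁ (lt , refl)            = before s lt
... | inj₂ (o , refl , po , refl) = proj₁ (after o po)

rowGrows : ∀ S R → ShapeChange S R → ∀ s r → backRow (proj₂ R) s ≡ just r → rowLen S r ≤ rowLen (proj₁ R) s
rowGrows S (S' , (p , suc c)) (others , grown , _) s .s refl with s ≟ p
... | yes refl = subst (rowLen S p ≤_) (sym grown) (n≤1+n _)
... | no  ne   = ≤-reflexive (sym (others s ne))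
rowGrows S (S' , (p , zero)) created s r e = ≤-reflexive (sym (rowCreated-length S S' p created s r e))

-- An upper row that is strictly shorter than a lower row stays strictly
-- shorter: only the upper row can grow, and appending a box to it never makes
-- it as long as the lower row (no lower row has the new length).
shorterStaysShorter : ∀ S R → ShapeChange S R → ∀ s s' r r' → s < s' →
  backRow (proj₂ R) s ≡ just r → backRow (proj₂ R) s' ≡ just r' →
  rowLen S r < rowLen S r' → rowLen (proj₁ R) s < rowLen (proj₁ R) s'
shorterStaysShorter S (S' , (p , suc c)) box@(others , grown , unmatched) s s' .s .s' lt refl refl shorter
  with s ≟ p
... | yes refl =
  subst₂ _<_ (sym grown) (sym (others s' (λ z → <-irrefl (sym z) lt)))
    (≤∧≢⇒< shorter (λ z → unmatched s' lt (sym z)))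
... | no ne = <-≤-trans (subst (_< rowLen S s') (sym (others s ne)) shorter)
                (rowGrows S (S' , (p , suc c)) box s' s' refl)
shorterStaysShorter S (S' , (p , zero)) created s s' r r' lt e e' shorter =
  subst₂ _<_ (sym (rowCreated-length S S' p created s r e)) (sym (rowCreated-length S S' p created s' r' e')) shorter

rowCreatedAt : ∀ S R p → proj₂ R ≡ (p , 0) → ShapeChange S R → RowCreated S (proj₁ R) p
rowCreatedAt S (S' , (.p , zero)) p refl created = created

downward-induction : ∀ {P : ℕ → Set} n → P n → (∀ j → j < n → P (suc j) → P j) → ∀ j → j ≤ n → P j
downward-induction {P} n base step j j≤n = go (n ∸ j) j (m∸n+n≡m j≤n)
  where
  go : ∀ m j → m + j ≡ n → P j
  go zero    j refl = base
  go (suc m) j e    = step j (≤-trans (s≤s (m≤n+m j m)) (≤-reflexive e)) (go m (suc j) (trans (+-suc m j) e))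

corr-last : ∀ U b m d r → suc d ≤ m →
  corr U b m (suc d) r ≡ (corr U b m d r >>= backRow (addedPos U b (m ∸ suc d)))
corr-last U b (suc m) zero    r _        with backRow (addedPos U b m) r
... | just x  = refl
... | nothing = refl
corr-last U b (suc m) (suc d) r (s≤s le) with backRow (addedPos U b m) r
... | nothing = refl
... | just r' = corr-last U b m d r' le

∸-suc : ∀ n j → j < n → n ∸ j ≡ suc (n ∸ suc j)
∸-suc (suc n) zero    _        = refl
∸-suc (suc n) (suc j) (s≤s lt) = ∸-suc n j lt

bind-just : ∀ (m : Maybe ℕ) (f : ℕ → Maybe ℕ) a → (m >>= f) ≡ just a → ∃ λ a₁ → m ≡ just a₁ × f a₁ ≡ just a
bind-just (just x) f a e = x , refl , e
bind-just nothing  f a ()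

module Sequence (U : Tableau) (rct : IsRCT U) (n : ℕ) (b : ℕ → ℕ) (bpos : ∀ j → 1 ≤ j → j ≤ n → 0 < b j) where

  Tab : ℕ → Tableau
  Tab = seqT U b

  -- ρ j r : the row of U_j corresponding to row r of U_n.
  ρ : ℕ → ℕ → Maybe ℕ
  ρ j r = corr U b n (n ∸ j) r

  ρ-n : ∀ r → ρ n r ≡ just r
  ρ-n r = cong (λ k → corr U b n k r) (n∸n≡0 n)

  ρ-step : ∀ j r → j < n → ρ j r ≡ (ρ (suc j) r >>= backRow (addedPos U b j))
  ρ-step j r lt = begin
    corr U b n (n ∸ j) r
      ≡⟨ cong (λ k → corr U b n k r) (∸-suc n j lt) ⟩
    corr U b n (suc (n ∸ suc j)) r
      ≡⟨ corr-last U b n (n ∸ suc j) r (subst (_≤ n) (∸-suc n j lt) (m∸n≤m n j)) ⟩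
    (ρ (suc j) r >>= backRow (addedPos U b (n ∸ suc (n ∸ suc j))))
      ≡⟨ cong (λ k → ρ (suc j) r >>= backRow (addedPos U b k)) back ⟩
    (ρ (suc j) r >>= backRow (addedPos U b j)) ∎
    where
    open ≡-Reasoning
    back : n ∸ suc (n ∸ suc j) ≡ j
    back = trans (cong (n ∸_) (sym (∸-suc n j lt))) (m∸[m∸n]≡n (<⇒≤ lt))

  ρ-back : ∀ j r a → j < n → ρ j r ≡ just a → ∃ λ a₁ → ρ (suc j) r ≡ just a₁ × backRow (addedPos U b j) a₁ ≡ just a
  ρ-back j r a lt e = bind-just (ρ (suc j) r) (backRow (addedPos U b j)) a (trans (sym (ρ-step j r lt)) e)

  definedLater : ∀ r k x → ρ k r ≡ just x → ∀ j → k ≤ j → j ≤ n → ∃ λ y → ρ j r ≡ just y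
  definedLater r k x ek zero    z≤n jn = x , ek
  definedLater r k x ek (suc j) kj jn with m≤n⇒m<n∨m≡n kj
  ... | inj₂ refl = x , ek
  ... | inj₁ (s≤s kj') with ρ (suc j) r in e | definedLater r k x ek j kj' (≤-trans (n≤1+n j) jn)
  ...   | just y  | _      = y , refl
  ...   | nothing | o , eo with () ← trans (sym eo) (trans (ρ-step j r jn) (cong (_>>= backRow (addedPos U b j)) e))

  good : ∀ j → j ≤ n → Good (Tab j)
  good zero    _  = rctGood U rct
  good (suc j) le = proj₁ (insertLemma (Tab j) (b (suc j)) (good j (≤-trans (n≤1+n j) le)) (bpos (suc j) (s≤s z≤n) le))

  shape : ∀ j → j < n → ShapeChange (Tab j) (insertPos (Tab j) (b (suc j)))
  shape j le = proj₂ (insertLemma (Tab j) (b (suc j)) (good j (<⇒≤ le)) (bpos (suc j) (s≤s z≤n) le))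

  lengthGrows : ∀ r k x → ρ k r ≡ just x → ∀ j → k ≤ j → j ≤ n → ∀ y → ρ j r ≡ just y → rowLen (Tab k) x ≤ rowLen (Tab j) y
  lengthGrows r k x ek zero    z≤n jn y ey = ≤-reflexive (cong (rowLen (Tab 0)) (just-injective (trans (sym ek) ey)))
  lengthGrows r k x ek (suc j) kj  jn y ey with m≤n⇒m<n∨m≡n kj
  ... | inj₂ refl = ≤-reflexive (cong (rowLen (Tab (suc j))) (just-injective (trans (sym ek) ey)))
  ... | inj₁ (s≤s kj') =
    let (o , eo) = definedLater r k x ek j kj' (≤-trans (n≤1+n j) jn)
        back     = trans (sym (trans (ρ-step j r jn) (cong (_>>= backRow (addedPos U b j)) ey))) eo
    in ≤-trans (lengthGrows r k x ek j kj' (≤-trans (n≤1+n j) jn) o eo)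
               (rowGrows (Tab j) (insertPos (Tab j) (b (suc j))) (shape j jn) y o back)

  createdNonempty : ∀ r j î → addedPos U b j ≡ (î , 0) → ρ (suc j) r ≡ just î →
    ∀ k → suc j ≤ k → k ≤ n → ∀ a → ρ k r ≡ just a → 1 ≤ rowLen (Tab k) a
  createdNonempty r j î added eî k jk kn a ea =
    ≤-trans (≤-reflexive (sym (proj₁ (proj₂ (rowCreatedAt (Tab j) (insertPos (Tab j) (b (suc j))) î added (shape j (≤-trans jk kn)))))))
            (lengthGrows r (suc j) î eî k jk kn a ea)

  module Rows (i i' : ℕ) (i<i' : i < i') (longer : rowLen (Tab n) i' ≤ rowLen (Tab n) i) where

    Ordered : ℕ → Set
    Ordered j = ∀ a a' → ρ j i ≡ just a → ρ j i' ≡ just a' → a < a'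

    ordered : ∀ j → j ≤ n → Ordered j
    ordered = downward-induction n base step
      where
      base : Ordered n
      base a a' ea ea' =
        subst₂ _<_ (just-injective (trans (sym (ρ-n i)) ea)) (just-injective (trans (sym (ρ-n i')) ea')) i<i'
      step : ∀ j → j < n → Ordered (suc j) → Ordered j
      step j lt ih a a' ea ea' =
        let (a₁  , e₁  , back)  = ρ-back j i  a  lt ea
            (a₁' , e₁' , back') = ρ-back j i' a' lt ea'
        in backRow-order (addedPos U b j) a₁ a₁' a a' (ih a₁ a₁' e₁ e₁') back back'

    NotShorter : ℕ → Set
    NotShorter j = ∀ a a' → ρ j i ≡ just a → ρ j i' ≡ just a' → rowLen (Tab j) a < rowLen (Tab j) a' → ⊥

    -- The row corresponding to i is never strictly shorter than the one
    -- corresponding to i': otherwise it would still be shorter in U_n.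
    notShorter : ∀ j → j ≤ n → NotShorter j
    notShorter = downward-induction n base step
      where
      base : NotShorter n
      base a a' ea ea' shorter =
        <-irrefl refl (≤-<-trans longer
          (subst₂ (λ x y → rowLen (Tab n) x < rowLen (Tab n) y)
             (sym (just-injective (trans (sym (ρ-n i)) ea))) (sym (just-injective (trans (sym (ρ-n i')) ea'))) shorter))
      step : ∀ j → j < n → NotShorter (suc j) → NotShorter j
      step j lt ih a a' ea ea' shorter =
        let (a₁  , e₁  , back)  = ρ-back j i  a  lt ea
            (a₁' , e₁' , back') = ρ-back j i' a' lt ea'
        in ih a₁ a₁' e₁ e₁'
             (shorterStaysShorter (Tab j) (insertPos (Tab j) (b (suc j))) (shape j lt) a₁ a₁' a a'
                (ordered (suc j) lt a₁ a₁' e₁ e₁') back back' shorter)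

    -- The row î cannot be created after the row î': at its creation it has
    -- length one, while the row î' below it already has length at least two.
    notCreatedLater : ∀ j₁ j₂ î î' → j₂ < j₁ → j₁ < n →
      ρ (suc j₁) i ≡ just î → addedPos U b j₁ ≡ (î , 0) →
      ρ (suc j₂) i' ≡ just î' → addedPos U b j₂ ≡ (î' , 0) → ⊥
    notCreatedLater j₁ j₂ î î' j₂<j₁ j₁<n eî added₁ eî' added₂ =
      lowerRow a' ea' (ordered (suc j₁) j₁<n î a' eî ea')
      where
      lower = definedLater i' (suc j₂) î' eî' (suc j₁) (<⇒≤ (s≤s j₂<j₁)) j₁<n
      a'  = proj₁ lower
      ea' = proj₂ lower
      created : RowCreated (Tab j₁) (Tab (suc j₁)) î
      created = rowCreatedAt (Tab j₁) (insertPos (Tab j₁) (b (suc j₁))) î added₁ (shape j₁ j₁<n)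
      lowerRow : ∀ a' → ρ (suc j₁) i' ≡ just a' → î < a' → ⊥
      lowerRow (suc o) ea' (s≤s î≤o) =
        let eo : ρ j₁ i' ≡ just o
            eo = trans (ρ-step j₁ i' j₁<n)
                   (trans (cong (_>>= backRow (addedPos U b j₁)) ea')
                     (trans (cong (λ z → backRow z (suc o)) added₁) (backRow-shifted î o î≤o)))
            nonempty = createdNonempty i' j₂ î' added₂ eî' j₁ j₂<j₁ (<⇒≤ j₁<n) o eo
            (shiftedLen , not1) = proj₂ (proj₂ created) o î≤o
        in notShorter (suc j₁) j₁<n î (suc o) eî ea'
             (subst₂ _<_ (sym (proj₁ (proj₂ created))) (sym shiftedLen) (≤∧≢⇒< nonempty (λ z → not1 (sym z))))

mainTheorem4 : (U : Tableau) → IsRCT U →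
    (n : ℕ) (b : ℕ → ℕ) → (∀ j → 1 ≤ j → j ≤ n → 0 < b j) →
    (i i' : ℕ) → i < i' → i' < length (seqT U b n) →
    rowLen (seqT U b n) i' ≤ rowLen (seqT U b n) i →
    (k₁ k₂ î î' : ℕ) → 1 ≤ k₁ → k₁ ≤ n → 1 ≤ k₂ → k₂ ≤ n →
    corr U b n (n ∸ k₁) i ≡ just î → addedPos U b (k₁ ∸ 1) ≡ (î , 0) →
    corr U b n (n ∸ k₂) i' ≡ just î' → addedPos U b (k₂ ∸ 1) ≡ (î' , 0) →
    (k₁ < k₂) ×
    (∀ j → k₂ ≤ j → j ≤ n →
      ∃₂ λ a a' → corr U b n (n ∸ j) i ≡ just a × corr U b n (n ∸ j) i' ≡ just a' ×
                  rowLen (seqT U b j) a' ≤ rowLen (seqT U b j) a)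
mainTheorem4 U rct n b bpos i i' i<i' _ longer (suc j₁) (suc j₂) î î' _ k₁≤n _ k₂≤n eî added₁ eî' added₂ =
  k₁<k₂ , lengths
  where
  open Sequence U rct n b bpos
  open Rows i i' i<i' longer
  -- Equal creation steps would create the same row; a later one is impossible.
  k₁<k₂ : suc j₁ < suc j₂
  k₁<k₂ with <-cmp (suc j₁) (suc j₂)
  ... | tri< lt _ _       = lt
  ... | tri≈ _ refl _     =
    ⊥-elim (<-irrefl (cong proj₁ (trans (sym added₁) added₂)) (ordered (suc j₁) k₁≤n î î' eî eî'))
  ... | tri> _ _ (s≤s gt) = ⊥-elim (notCreatedLater j₁ j₂ î î' gt k₁≤n eî added₁ eî' added₂)
  lengths : ∀ j → suc j₂ ≤ j → j ≤ n →
    ∃₂ λ a a' → ρ j i ≡ just a × ρ j i' ≡ just a' × rowLen (Tab j) a' ≤ rowLen (Tab j) a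
  lengths j k₂≤j j≤n =
    let (a  , ea)  = definedLater i  (suc j₁) î  eî  j (≤-trans (<⇒≤ k₁<k₂) k₂≤j) j≤n
        (a' , ea') = definedLater i' (suc j₂) î' eî' j k₂≤j j≤n
    in a , a' , ea , ea' , ≮⇒≥ (notShorter j j≤n a a' ea ea')
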